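{- Let $(X,\mathcal{B})$ be a resolvable $(v,k,\lambda)$-BIBD with replication number $r=\lambda(v-1)/(k-1)$, fix a resolution of it into parallel classes $\Pi_1,\dots,\Pi_r$, and let $w=v/k$. Let $(Y,\mathcal{C})$ be a $3$-$(w,k',\lambda')$-design on $Y=\{1,\dots,w\}$, and let $(X,\mathcal{D})$ be the constructed design obtained from these two designs (as described in the context). Let $\lambda_2' = \lambda'\frac{w-2}{k'-2}$ and $r' = \lambda'\frac{(w-1)(w-2)}{(k'-1)(k'-2)}$ be the numbers of blocks of $(Y,\mathcal{C})$ containing a given pair, respectively a given point. Suppose three distinct points $x,y,z\in X$ occur together in exactly $\alpha$ blocks of $\mathcal{B}$, and let $\lambda_{x,y,z}$ denote the number of blocks of $\mathcal{D}$ (counted with multiplicity) containing $x$, $y$ and $z$. Then \[ \lambda_{x,y,z} = \alpha r' + 3(\lambda-\alpha)\lambda_2' + \bigl(r-\alpha-3(\lambda-\alpha)\bigr)\lambda'. \]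
   Context: For positive integers $v,b,r,k$ with $2\le k<v$, a $(v,b,r,k)$-incomplete block design (IBD) is a pair $(X,\mathcal{B})$ where $X$ is a set of $v$ points and $\mathcal{B}$ is a multiset of $b$ subsets of $X$ (blocks), each of size $k$, such that every point lies in exactly $r$ blocks. If $k\mid v$, a parallel class is a set of $v/k$ pairwise disjoint blocks; the IBD is resolvable if $\mathcal{B}$ can be partitioned into $r$ parallel classes (a resolution). A $(v,k,\lambda)$-BIBD is an IBD with block size $k$ in which every pair of distinct points lies in exactly $\lambda$ blocks. For $t\le k<v$, a $t$-$(v,k,\lambda)$-design is a pair $(X,\mathcal{B})$ with $|X|=v$ and $\mathcal{B}$ a multiset of $k$-subsets of $X$ such that every $t$-subset of $X$ lies in exactly $\lambda$ blocks; every $j$-subset with $j\le t$ then lies in exactly $\lambda\binom{v-j}{t-j}/\binom{k-j}{t-j}$ blocks. Constructed design: given a resolvable IBD $(X,\mathcal{B})$ with block size $k$ and a resolution into parallel classes $\Pi_1,\dots,\Pi_r$, where $\Pi_i=\{B_i^1,\dots,B_i^w\}$ and $w=v/k$, and given an IBD $(Y,\mathcal{C})$ with $Y=\{1,\dots,w\}$, define for each $i\in\{1,\dots,r\}$ and each block $C\in\mathcal{C}$ the set $D_{i,C}=\bigcup_{j\in C}B_i^j$, and let $\mathcal{D}$ be the multiset $\{D_{i,C}: 1\le i\le r,\ C\in\mathcal{C}\}$ (one member for each $i$ and each block of the multiset $\mathcal{C}$). The constructed design is $(X,\mathcal{D})$. -}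

module Defs where

open import Data.Nat using (ℕ; _≤_; _<_; _*_)
open import Data.Fin using (Fin)
open import Data.Fin.Subset using (Subset; _∈_; ∣_∣; ⋃)
open import Data.Fin.Subset.Properties using (_∈?_)
open import Data.List using (List; length; filter; map; concatMap; allFin)
open import Data.Product using (_×_)
open import Relation.Nullary using (¬_)
open import Relation.Nullary.Decidable using (_×-dec_)
open import Relation.Binary.PropositionalEquality using (_≡_; _≢_)

countPair : ∀ {n} → Fin n → Fin n → List (Subset n) → ℕ
countPair x y bs = length (filter (λ B → (x ∈? B) ×-dec (y ∈? B)) bs)

countTriple : ∀ {n} → Fin n → Fin n → Fin n → List (Subset n) → ℕ
countTriple x y z bs =
  length (filter (λ B → (x ∈? B) ×-dec ((y ∈? B) ×-dec (z ∈? B))) bs)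

-- A resolvable IBD given together with a fixed resolution:
-- P i j is the block B_i^j (i-th parallel class, j-th block), 1 ≤ j ≤ w.
Resolution : ℕ → ℕ → ℕ → Set
Resolution v r w = Fin r → Fin w → Subset v

blocksOf : ∀ {v r w} → Resolution v r w → List (Subset v)
blocksOf {r = r} {w} P = concatMap (λ i → map (P i) (allFin w)) (allFin r)

IsResolution : ∀ {v r w} → ℕ → Resolution v r w → Set
IsResolution {v} {r} {w} k P =
  (2 ≤ k) × (k < v) × (v ≡ k * w)
  × (∀ i j → ∣ P i j ∣ ≡ k)
  × (∀ i j j' (x : Fin v) → x ∈ P i j → x ∈ P i j' → j ≡ j')

IsResolvableBIBD : ∀ {v r w} → ℕ → ℕ → Resolution v r w → Set
IsResolvableBIBD {v} k lam P =
  IsResolution k P × (∀ (x y : Fin v) → x ≢ y → countPair x y (blocksOf P) ≡ lam)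

Is3Design : (w k' λ' : ℕ) → List (Subset w) → Set
Is3Design w k' λ' Cs =
  (3 ≤ k') × (k' < w)
  × (∀ C → C Data.List.Membership.Propositional.∈ Cs → ∣ C ∣ ≡ k')
  × (∀ (a b c : Fin w) → a ≢ b → a ≢ c → b ≢ c → countTriple a b c Cs ≡ λ')
  where import Data.List.Membership.Propositional

Dblock : ∀ {v r w} → Resolution v r w → Fin r → Subset w → Subset v
Dblock {w = w} P i C = ⋃ (map (P i) (filter (_∈? C) (allFin w)))

constructed : ∀ {v r w} → Resolution v r w → List (Subset w) → List (Subset v)
constructed {r = r} P Cs = concatMap (λ i → map (Dblock P i) Cs) (allFin r)

-- Let a_i, b_i, c_i index the blocks of the i-th parallel class containing x, y, z.
-- Then x, y, z ∈ D_{i,C} iff a_i, b_i, c_i ∈ C, so λ_{x,y,z} = Σ_i λ_𝒞(a_i, b_i, c_i),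
-- and λ_𝒞(a, b, c) is λ', λ₂' or r' according as a, b, c are distinct, exactly two
-- coincide, or all coincide (that pairs and points of a 3-design lie in λ₂' and r' blocks
-- follows by counting the flags (C, c) with c ∈ C ⊇ {a, b} in two ways). All three
-- indices coincide in the α classes holding a block through x, y, z, and each pair of
-- them in λ classes, so exactly two coincide in 3(λ − α) classes.
module Submission where

open import Defs
import Data.Nat.Properties as ℕ
open import Algebra.Properties.CommutativeMonoid.Sum ℕ.+-0-commutativeMonoid
  using (sum; sum-syntax; sum-remove; ∑-distrib-+; ∑-comm; sum-cong-≗)
open import Algebra.Properties.CommutativeSemigroup ℕ.+-commutativeSemigroup
  using () renaming (x∙yz≈y∙xz to x+[y+z]≡y+[x+z])
open import Algebra.Properties.CommutativeSemigroup ℕ.*-commutativeSemigroup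
  using () renaming (x∙yz≈y∙xz to x*[y*z]≡y*[x*z])
open import Algebra.Properties.Semiring.Sum ℕ.+-*-semiring using (*-distribˡ-sum)
open import Data.Nat using (ℕ; zero; suc; _+_; _*_; _∸_; _≤_; _<_; z≤n; s≤s; NonZero; >-nonZero)
open import Data.Fin using (Fin; zero; suc; punchIn; punchOut)
open import Data.Fin.Properties using (_≟_; any?; punchIn-punchOut; punchInᵢ≢i; punchIn-injective)
import Data.Fin.Properties as Fin
open import Data.Fin.Subset using (Subset; _∈_; ∣_∣; ⋃; inside; outside)
open import Data.Fin.Subset.Properties using (_∈?_; x∈p∪q⁻; x∈p∪q⁺; ∉⊥; drop-there)
open import Data.List using (List; []; _∷_; _++_; length; filter; map; concatMap; tabulate; allFin)
open import Data.List.Properties using (filter-++; length-++; map-tabulate; map-id)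
open import Data.List.Membership.Propositional using () renaming (_∈_ to _∈ˡ_)
open import Data.List.Membership.Propositional.Properties
  using (∈-map⁺; ∈-map⁻; ∈-filter⁺; ∈-filter⁻; ∈-allFin)
open import Data.List.Relation.Unary.Any using (here; there)
open import Data.Product using (_×_; _,_; proj₁; proj₂; ∃)
open import Data.Product.Function.NonDependent.Propositional using (_×-⇔_)
open import Data.Sum using (inj₁; inj₂)
open import Data.Vec using ([]; _∷_; there)
open import Data.Vec.Functional using (removeAt)
open import Function using (_∘_; _⇔_; mk⇔; Equivalence)
open import Level using (Level)
open import Relation.Nullary using (¬_; Dec; yes; no; contradiction)
open import Relation.Nullary.Decidable using (_×-dec_)
open import Relation.Unary using (Pred; Decidable)
open import Relation.Binary.PropositionalEquality

private
  variable
    a b p q : Level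
    A : Set a
    B : Set b
    n : ℕ

χ : Dec A → ℕ
χ (yes _) = 1
χ (no _)  = 0

χ-cong : A ⇔ B → (A? : Dec A) (B? : Dec B) → χ A? ≡ χ B?
χ-cong A⇔B (yes _) (yes _)  = refl
χ-cong A⇔B (yes x) (no ¬y)  = contradiction (Equivalence.to A⇔B x) ¬y
χ-cong A⇔B (no ¬x) (yes y)  = contradiction (Equivalence.from A⇔B y) ¬x
χ-cong A⇔B (no _)  (no _)   = refl

χ-¬ : ¬ A → (A? : Dec A) → χ A? ≡ 0
χ-¬ ¬x (yes x) = contradiction x ¬x
χ-¬ ¬x (no _)  = refl

χ≤1 : (A? : Dec A) → χ A? ≤ 1
χ≤1 (yes _) = s≤s z≤n
χ≤1 (no _)  = z≤n

χ-×-dec : (A? : Dec A) (B? : Dec B) → χ (A? ×-dec B?) ≡ χ A? * χ B?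
χ-×-dec (yes _) (yes _) = refl
χ-×-dec (yes _) (no _)  = refl
χ-×-dec (no _)  (yes _) = refl
χ-×-dec (no _)  (no _)  = refl

∑-const : ∀ n x → ∑[ i < n ] x ≡ n * x
∑-const zero    x = refl
∑-const (suc n) x = cong (x +_) (∑-const n x)

∑-const-off₁ : (f : Fin n → ℕ) (a : Fin n) {x : ℕ} →
  (∀ c → c ≢ a → f c ≡ x) → sum f ≡ f a + (n ∸ 1) * x
∑-const-off₁ {suc n} f zero {x} off =
  cong (f zero +_) (trans (sum-cong-≗ (λ c → off (suc c) λ ())) (∑-const n x))
∑-const-off₁ {suc (suc n)} f (suc a) {x} off = begin
  f zero + sum (f ∘ suc)     ≡⟨ cong₂ _+_ (off zero λ ()) (∑-const-off₁ (f ∘ suc) a off′) ⟩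
  x + (f (suc a) + n * x)    ≡⟨ x+[y+z]≡y+[x+z] x (f (suc a)) (n * x) ⟩
  f (suc a) + (x + n * x)    ∎
  where
  open ≡-Reasoning
  off′ : ∀ c → c ≢ a → f (suc c) ≡ x
  off′ c c≢a = off (suc c) (c≢a ∘ Fin.suc-injective)

∑-const-off₂ : (f : Fin n → ℕ) {a b : Fin n} {x : ℕ} → a ≢ b →
  (∀ c → c ≢ a → c ≢ b → f c ≡ x) → sum f ≡ f a + f b + (n ∸ 2) * x
∑-const-off₂ {suc n} f {a} {b} {x} a≢b off = begin
  sum f                                              ≡⟨ sum-remove f ⟩
  f a + sum (removeAt f a)                           ≡⟨ cong (f a +_) (∑-const-off₁ (removeAt f a) (punchOut a≢b) off′) ⟩
  f a + (f (punchIn a (punchOut a≢b)) + (n ∸ 1) * x) ≡⟨ cong (λ c → f a + (f c + (n ∸ 1) * x)) (punchIn-punchOut a≢b) ⟩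
  f a + (f b + (n ∸ 1) * x)                          ≡⟨ ℕ.+-assoc (f a) (f b) _ ⟨
  f a + f b + (n ∸ 1) * x                            ∎
  where
  open ≡-Reasoning
  off′ : ∀ c → c ≢ punchOut a≢b → removeAt f a c ≡ x
  off′ c c≢b′ = off (punchIn a c) (punchInᵢ≢i a c) λ c↑≡b →
    c≢b′ (punchIn-injective a c _ (trans c↑≡b (sym (punchIn-punchOut a≢b))))

∑-supported : (f : Fin n → ℕ) (a : Fin n) → (∀ c → c ≢ a → f c ≡ 0) → sum f ≡ f a
∑-supported {n} f a off = begin
  sum f                ≡⟨ ∑-const-off₁ f a off ⟩
  f a + (n ∸ 1) * 0    ≡⟨ cong (f a +_) (ℕ.*-zeroʳ (n ∸ 1)) ⟩
  f a + 0              ≡⟨ ℕ.+-identityʳ (f a) ⟩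
  f a                  ∎
  where open ≡-Reasoning

∑≤n : (f : Fin n → ℕ) → (∀ i → f i ≤ 1) → sum f ≤ n
∑≤n {zero}  f f≤1 = z≤n
∑≤n {suc n} f f≤1 = ℕ.+-mono-≤ (f≤1 zero) (∑≤n (f ∘ suc) (f≤1 ∘ suc))

∑≡n⇒positive : (f : Fin n → ℕ) → (∀ i → f i ≤ 1) → sum f ≡ n → ∀ i → 0 < f i
∑≡n⇒positive {suc n} f f≤1 ∑f≡n i = ℕ.+-cancelʳ-≤ n 1 (f i) (begin
  suc n                      ≡⟨ ∑f≡n ⟨
  sum f                      ≡⟨ sum-remove f ⟩
  f i + sum (removeAt f i)   ≤⟨ ℕ.+-monoʳ-≤ (f i) (∑≤n (removeAt f i) (f≤1 ∘ punchIn i)) ⟩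
  f i + n                    ∎)
  where open ℕ.≤-Reasoning

module _ {Q : Pred (Fin n) p} (Q? : Decidable Q) where

  ∑χ-empty : ¬ ∃ Q → ∑[ j < n ] χ (Q? j) ≡ 0
  ∑χ-empty ∄Q = trans (sum-cong-≗ (λ j → χ-¬ (∄Q ∘ (j ,_)) (Q? j))) (trans (∑-const n 0) (ℕ.*-zeroʳ n))

  ∑χ-positive⇒∃ : 0 < ∑[ j < n ] χ (Q? j) → ∃ Q
  ∑χ-positive⇒∃ pos with any? Q?
  ... | yes ∃Q = ∃Q
  ... | no ∄Q  = contradiction (∑χ-empty ∄Q) (ℕ.n>0⇒n≢0 pos)

  ∑χ≤1 : (∀ j j′ → Q j → Q j′ → j ≡ j′) → ∑[ j < n ] χ (Q? j) ≤ 1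
  ∑χ≤1 unique with any? Q?
  ... | no ∄Q        = ℕ.≤-trans (ℕ.≤-reflexive (∑χ-empty ∄Q)) z≤n
  ... | yes (j , qj) = ℕ.≤-trans (ℕ.≤-reflexive (∑-supported (χ ∘ Q?) j off)) (χ≤1 (Q? j))
    where
    off : ∀ c → c ≢ j → χ (Q? c) ≡ 0
    off c c≢j = χ-¬ (λ qc → c≢j (unique c j qc qj)) (Q? c)

count : {P : Pred A p} → Decidable P → List A → ℕ
count P? xs = length (filter P? xs)

count-∷ : {P : Pred A p} (P? : Decidable P) → ∀ x xs → count P? (x ∷ xs) ≡ χ (P? x) + count P? xs
count-∷ P? x xs with P? x
... | yes _ = refl
... | no _  = refl

module _ {P : Pred A p} (P? : Decidable P) where

  count-++ : ∀ xs ys → count P? (xs ++ ys) ≡ count P? xs + count P? ys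
  count-++ xs ys = trans (cong length (filter-++ P? xs ys)) (length-++ (filter P? xs))

  count-tabulate : (h : Fin n → A) → count P? (tabulate h) ≡ ∑[ i < n ] χ (P? (h i))
  count-tabulate {n = zero}  h = refl
  count-tabulate {n = suc n} h = trans (count-∷ P? (h zero) _) (cong (χ (P? (h zero)) +_) (count-tabulate (h ∘ suc)))

  count-concatMap-tabulate : (g : B → List A) (h : Fin n → B) →
    count P? (concatMap g (tabulate h)) ≡ ∑[ i < n ] count P? (g (h i))
  count-concatMap-tabulate {n = zero}  g h = refl
  count-concatMap-tabulate {n = suc n} g h =
    trans (count-++ (g (h zero)) _) (cong (count P? (g (h zero)) +_) (count-concatMap-tabulate g (h ∘ suc)))

  count-map : {Q : Pred B q} (Q? : Decidable Q) (f : B → A) → (∀ x → P (f x) ⇔ Q x) →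
    ∀ xs → count P? (map f xs) ≡ count Q? xs
  count-map Q? f P∘f⇔Q []       = refl
  count-map Q? f P∘f⇔Q (x ∷ xs) = begin
    count P? (f x ∷ map f xs)          ≡⟨ count-∷ P? (f x) (map f xs) ⟩
    χ (P? (f x)) + count P? (map f xs) ≡⟨ cong₂ _+_ (χ-cong (P∘f⇔Q x) (P? (f x)) (Q? x)) (count-map Q? f P∘f⇔Q xs) ⟩
    χ (Q? x) + count Q? xs             ≡⟨ count-∷ Q? x xs ⟨
    count Q? (x ∷ xs)                  ∎
    where open ≡-Reasoning

  count-cong : {Q : Pred A q} (Q? : Decidable Q) → (∀ x → P x ⇔ Q x) → ∀ xs → count P? xs ≡ count Q? xs
  count-cong Q? P⇔Q xs = trans (cong (count P?) (sym (map-id xs))) (count-map Q? (λ x → x) P⇔Q xs)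

∣p∣≡∑χ : (p : Subset n) → ∣ p ∣ ≡ ∑[ c < n ] χ (c ∈? p)
∣p∣≡∑χ []            = refl
∣p∣≡∑χ (inside ∷ p)  = cong suc (trans (∣p∣≡∑χ p) (sum-cong-≗ λ c → χ-cong (mk⇔ there drop-there) (c ∈? p) _))
∣p∣≡∑χ (outside ∷ p) = trans (∣p∣≡∑χ p) (sum-cong-≗ λ c → χ-cong (mk⇔ there drop-there) (c ∈? p) _)

∑-count-∈ : ∀ {k} {P : Pred (Subset n) p} (P? : Decidable P) (Cs : List (Subset n)) →
  (∀ C → C ∈ˡ Cs → ∣ C ∣ ≡ k) →
  ∑[ c < n ] count (λ C → P? C ×-dec c ∈? C) Cs ≡ k * count P? Cs
∑-count-∈ {n = n} {k = k} P? [] _ = trans (∑-const n 0) (trans (ℕ.*-zeroʳ n) (sym (ℕ.*-zeroʳ k)))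
∑-count-∈ {n = n} {k = k} P? (C ∷ Cs) size = begin
  ∑[ c < n ] count (λ D → P? D ×-dec c ∈? D) (C ∷ Cs)
    ≡⟨ sum-cong-≗ (λ c → count-∷ (λ D → P? D ×-dec c ∈? D) C Cs) ⟩
  ∑[ c < n ] (χ (P? C ×-dec c ∈? C) + count (λ D → P? D ×-dec c ∈? D) Cs)
    ≡⟨ ∑-distrib-+ {n} (λ c → χ (P? C ×-dec c ∈? C)) _ ⟩
  ∑[ c < n ] χ (P? C ×-dec c ∈? C) + ∑[ c < n ] count (λ D → P? D ×-dec c ∈? D) Cs
    ≡⟨ cong₂ _+_ flags-in-C (∑-count-∈ P? Cs (λ D → size D ∘ there)) ⟩
  χ (P? C) * k + k * count P? Cs
    ≡⟨ cong (_+ k * count P? Cs) (ℕ.*-comm (χ (P? C)) k) ⟩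
  k * χ (P? C) + k * count P? Cs
    ≡⟨ ℕ.*-distribˡ-+ k (χ (P? C)) _ ⟨
  k * (χ (P? C) + count P? Cs)
    ≡⟨ cong (k *_) (count-∷ P? C Cs) ⟨
  k * count P? (C ∷ Cs) ∎
  where
  open ≡-Reasoning
  flags-in-C : ∑[ c < n ] χ (P? C ×-dec c ∈? C) ≡ χ (P? C) * k
  flags-in-C = begin
    ∑[ c < n ] χ (P? C ×-dec c ∈? C)   ≡⟨ sum-cong-≗ (λ c → χ-×-dec (P? C) (c ∈? C)) ⟩
    ∑[ c < n ] (χ (P? C) * χ (c ∈? C)) ≡⟨ *-distribˡ-sum {n} (χ (P? C)) (λ c → χ (c ∈? C)) ⟨
    χ (P? C) * ∑[ c < n ] χ (c ∈? C)   ≡⟨ cong (χ (P? C) *_) (trans (sym (∣p∣≡∑χ C)) (size C (here refl))) ⟩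
    χ (P? C) * k                       ∎

∈-⋃⁻ : {x : Fin n} (ps : List (Subset n)) → x ∈ ⋃ ps → ∃ λ p → p ∈ˡ ps × x ∈ p
∈-⋃⁻ []       x∈⋃ = contradiction x∈⋃ ∉⊥
∈-⋃⁻ (p ∷ ps) x∈⋃ with x∈p∪q⁻ p (⋃ ps) x∈⋃
... | inj₁ x∈p  = p , here refl , x∈p
... | inj₂ x∈⋃′ with ∈-⋃⁻ ps x∈⋃′
...   | q , q∈ps , x∈q = q , there q∈ps , x∈q

∈-⋃⁺ : {x : Fin n} {p : Subset n} {ps : List (Subset n)} → p ∈ˡ ps → x ∈ p → x ∈ ⋃ ps
∈-⋃⁺ (here refl)  x∈p = x∈p∪q⁺ (inj₁ x∈p)
∈-⋃⁺ (there p∈ps) x∈p = x∈p∪q⁺ (inj₂ (∈-⋃⁺ p∈ps x∈p))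

allEqual? : (a b c : Fin n) → Dec (a ≡ b × a ≡ c)
allEqual? a b c = (a ≟ b) ×-dec (a ≟ c)

coincidences : (a b c : Fin n) → ℕ
coincidences a b c = χ (a ≟ b) + χ (a ≟ c) + χ (b ≟ c)

module _ {v r w : ℕ} (P : Resolution v r w) {Q : Pred (Subset v) q} (Q? : Decidable Q) where

  count-blocksOf : count Q? (blocksOf P) ≡ ∑[ i < r ] ∑[ j < w ] χ (Q? (P i j))
  count-blocksOf = trans (count-concatMap-tabulate Q? (λ i → map (P i) (allFin w)) (λ i → i)) (sum-cong-≗ λ i →
    trans (cong (count Q?) (map-tabulate (λ j → j) (P i))) (count-tabulate Q? (P i)))

  count-constructed : (Cs : List (Subset w)) →
    count Q? (constructed P Cs) ≡ ∑[ i < r ] count Q? (map (Dblock P i) Cs)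
  count-constructed Cs = count-concatMap-tabulate Q? (λ i → map (Dblock P i) Cs) (λ i → i)

module ResolutionCounts {v r w k : ℕ} (P : Resolution v r w)
  (v≡kw : v ≡ k * w) (∣P∣≡k : ∀ i j → ∣ P i j ∣ ≡ k)
  (disjoint : ∀ i j j′ (x : Fin v) → x ∈ P i j → x ∈ P i j′ → j ≡ j′) where

  -- The w disjoint blocks of a class have total size k w = v, so they cover every point.
  ∈-some-block : ∀ i x → ∃ λ j → x ∈ P i j
  ∈-some-block i x =
    ∑χ-positive⇒∃ (λ j → x ∈? P i j) (∑≡n⇒positive blocksThrough blocksThrough≤1 total x)
    where
    blocksThrough : Fin v → ℕ
    blocksThrough y = ∑[ j < w ] χ (y ∈? P i j)
    blocksThrough≤1 : ∀ y → blocksThrough y ≤ 1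
    blocksThrough≤1 y = ∑χ≤1 (λ j → y ∈? P i j) (λ j j′ → disjoint i j j′ y)
    total : sum blocksThrough ≡ v
    total = begin
      ∑[ y < v ] ∑[ j < w ] χ (y ∈? P i j) ≡⟨ ∑-comm (λ y j → χ (y ∈? P i j)) ⟩
      ∑[ j < w ] ∑[ y < v ] χ (y ∈? P i j) ≡⟨ sum-cong-≗ (λ j → trans (sym (∣p∣≡∑χ (P i j))) (∣P∣≡k i j)) ⟩
      ∑[ j < w ] k                         ≡⟨ ∑-const w k ⟩
      w * k                                ≡⟨ ℕ.*-comm w k ⟩
      k * w                                ≡⟨ v≡kw ⟨
      v                                    ∎
      where open ≡-Reasoning

  blockIndex : Fin v → Fin r → Fin w
  blockIndex x i = proj₁ (∈-some-block i x)

  ∈-blockIndex : ∀ x i → x ∈ P i (blockIndex x i)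
  ∈-blockIndex x i = proj₂ (∈-some-block i x)

  ∈⇔≡blockIndex : ∀ x i j → x ∈ P i j ⇔ j ≡ blockIndex x i
  ∈⇔≡blockIndex x i j = mk⇔ (λ x∈ → disjoint i j (blockIndex x i) x x∈ (∈-blockIndex x i))
                             (λ { refl → ∈-blockIndex x i })

  ∈-Dblock⇔ : ∀ x i C → x ∈ Dblock P i C ⇔ blockIndex x i ∈ C
  ∈-Dblock⇔ x i C = mk⇔ to from
    where
    to : x ∈ Dblock P i C → blockIndex x i ∈ C
    to x∈D with ∈-⋃⁻ (map (P i) (filter (_∈? C) (allFin w))) x∈D
    ... | _ , B∈ , x∈B with ∈-map⁻ (P i) B∈
    ...   | j , j∈ , refl =
      subst (_∈ C) (Equivalence.to (∈⇔≡blockIndex x i j) x∈B) (proj₂ (∈-filter⁻ (_∈? C) {xs = allFin w} j∈))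
    from : blockIndex x i ∈ C → x ∈ Dblock P i C
    from bx∈C = ∈-⋃⁺ (∈-map⁺ (P i) (∈-filter⁺ (_∈? C) (∈-allFin _) bx∈C)) (∈-blockIndex x i)

  ∑-blocks-through : ∀ x i {R : Pred (Subset v) q} (R? : Decidable R) →
    ∑[ j < w ] χ (x ∈? P i j ×-dec R? (P i j)) ≡ χ (R? (P i (blockIndex x i)))
  ∑-blocks-through x i R? = trans (∑-supported (λ j → χ (x ∈? P i j ×-dec R? (P i j))) (blockIndex x i) off)
    (χ-cong (mk⇔ proj₂ (∈-blockIndex x i ,_)) _ _)
    where
    off : ∀ j → j ≢ blockIndex x i → χ (x ∈? P i j ×-dec R? (P i j)) ≡ 0
    off j j≢bx = χ-¬ (λ (x∈ , _) → j≢bx (Equivalence.to (∈⇔≡blockIndex x i j) x∈)) (x ∈? P i j ×-dec R? (P i j))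

  countPair-blocksOf : ∀ x y →
    countPair x y (blocksOf P) ≡ ∑[ i < r ] χ (blockIndex x i ≟ blockIndex y i)
  countPair-blocksOf x y = trans (count-blocksOf P _) (sum-cong-≗ λ i →
    trans (∑-blocks-through x i (y ∈?_)) (χ-cong (∈⇔≡blockIndex y i _) _ _))

  countTriple-blocksOf : ∀ x y z →
    countTriple x y z (blocksOf P) ≡ ∑[ i < r ] χ (allEqual? (blockIndex x i) (blockIndex y i) (blockIndex z i))
  countTriple-blocksOf x y z = trans (count-blocksOf P _) (sum-cong-≗ λ i →
    trans (∑-blocks-through x i (λ B → y ∈? B ×-dec z ∈? B))
          (χ-cong (∈⇔≡blockIndex y i _ ×-⇔ ∈⇔≡blockIndex z i _) _ _))

  ∑-coincidences : ∀ x y z →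
    ∑[ i < r ] coincidences (blockIndex x i) (blockIndex y i) (blockIndex z i)
    ≡ countPair x y (blocksOf P) + countPair x z (blocksOf P) + countPair y z (blocksOf P)
  ∑-coincidences x y z = begin
    ∑[ i < r ] (χ (bx i ≟ by i) + χ (bx i ≟ bz i) + χ (by i ≟ bz i))
      ≡⟨ ∑-distrib-+ (λ i → χ (bx i ≟ by i) + χ (bx i ≟ bz i)) _ ⟩
    ∑[ i < r ] (χ (bx i ≟ by i) + χ (bx i ≟ bz i)) + ∑[ i < r ] χ (by i ≟ bz i)
      ≡⟨ cong (_+ ∑[ i < r ] χ (by i ≟ bz i)) (∑-distrib-+ (λ i → χ (bx i ≟ by i)) _) ⟩
    ∑[ i < r ] χ (bx i ≟ by i) + ∑[ i < r ] χ (bx i ≟ bz i) + ∑[ i < r ] χ (by i ≟ bz i)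
      ≡⟨ sym (cong₂ _+_ (cong₂ _+_ (countPair-blocksOf x y) (countPair-blocksOf x z)) (countPair-blocksOf y z)) ⟩
    countPair x y (blocksOf P) + countPair x z (blocksOf P) + countPair y z (blocksOf P) ∎
    where
    open ≡-Reasoning
    bx by bz : Fin r → Fin w
    bx = blockIndex x
    by = blockIndex y
    bz = blockIndex z

  countTriple-constructed : (Cs : List (Subset w)) → ∀ x y z →
    countTriple x y z (constructed P Cs)
    ≡ ∑[ i < r ] countTriple (blockIndex x i) (blockIndex y i) (blockIndex z i) Cs
  countTriple-constructed Cs x y z = trans (count-constructed P _ Cs) (sum-cong-≗ λ i →
    count-map (λ B → x ∈? B ×-dec y ∈? B ×-dec z ∈? B)
              (λ C → blockIndex x i ∈? C ×-dec blockIndex y i ∈? C ×-dec blockIndex z i ∈? C)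
              (Dblock P i) (λ C → ∈-Dblock⇔ x i C ×-⇔ ∈-Dblock⇔ y i C ×-⇔ ∈-Dblock⇔ z i C) Cs)

module _ (Cs : List (Subset n)) where

  countTriple-aab : ∀ a c → countTriple a a c Cs ≡ countPair a c Cs
  countTriple-aab a c = count-cong (λ C → a ∈? C ×-dec a ∈? C ×-dec c ∈? C) (λ C → a ∈? C ×-dec c ∈? C)
    (λ _ → mk⇔ proj₂ (λ (a∈ , c∈) → a∈ , a∈ , c∈)) Cs

  countTriple-aba : ∀ a b → countTriple a b a Cs ≡ countPair a b Cs
  countTriple-aba a b = count-cong (λ C → a ∈? C ×-dec b ∈? C ×-dec a ∈? C) (λ C → a ∈? C ×-dec b ∈? C)
    (λ _ → mk⇔ (λ (a∈ , b∈ , _) → a∈ , b∈) (λ (a∈ , b∈) → a∈ , b∈ , a∈)) Cs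

  countTriple-abb : ∀ a b → countTriple a b b Cs ≡ countPair a b Cs
  countTriple-abb a b = count-cong (λ C → a ∈? C ×-dec b ∈? C ×-dec b ∈? C) (λ C → a ∈? C ×-dec b ∈? C)
    (λ _ → mk⇔ (λ (a∈ , b∈ , _) → a∈ , b∈) (λ (a∈ , b∈) → a∈ , b∈ , b∈)) Cs

  ∑-countTriple : ∀ {k} → (∀ C → C ∈ˡ Cs → ∣ C ∣ ≡ k) →
    ∀ a b → ∑[ c < n ] countTriple a b c Cs ≡ k * countPair a b Cs
  ∑-countTriple ∣C∣≡k a b = trans
    (sum-cong-≗ λ c → count-cong (λ C → a ∈? C ×-dec b ∈? C ×-dec c ∈? C)
      (λ C → (a ∈? C ×-dec b ∈? C) ×-dec c ∈? C)
      (λ _ → mk⇔ (λ (a∈ , b∈ , c∈) → (a∈ , b∈) , c∈) (λ ((a∈ , b∈) , c∈) → a∈ , b∈ , c∈)) Cs)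
    (∑-count-∈ (λ C → a ∈? C ×-dec b ∈? C) Cs ∣C∣≡k)

k*p≡m*p+x⇒[k∸m]*p≡x : ∀ k m p x → k * p ≡ m * p + x → (k ∸ m) * p ≡ x
k*p≡m*p+x⇒[k∸m]*p≡x k m p x eq = begin
  (k ∸ m) * p       ≡⟨ ℕ.*-distribʳ-∸ p k m ⟩
  k * p ∸ m * p     ≡⟨ cong (_∸ m * p) eq ⟩
  m * p + x ∸ m * p ≡⟨ ℕ.m+n∸m≡n (m * p) x ⟩
  x                 ∎
  where open ≡-Reasoning

module ThreeDesignCounts {w k' λ' : ℕ} (Cs : List (Subset w))
  (3≤k' : 3 ≤ k') (∣C∣≡k' : ∀ C → C ∈ˡ Cs → ∣ C ∣ ≡ k')
  (λ'-triples : ∀ a b c → a ≢ b → a ≢ c → b ≢ c → countTriple a b c Cs ≡ λ')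
  (λ₂' r' : ℕ) (λ₂'-def : λ₂' * (k' ∸ 2) ≡ λ' * (w ∸ 2))
  (r'-def : r' * ((k' ∸ 1) * (k' ∸ 2)) ≡ λ' * ((w ∸ 1) * (w ∸ 2))) where

  private
    instance
      k'∸1≢0 : NonZero (k' ∸ 1)
      k'∸1≢0 = >-nonZero (ℕ.m<n⇒0<n∸m (ℕ.≤-trans (ℕ.n≤1+n 2) 3≤k'))
      k'∸2≢0 : NonZero (k' ∸ 2)
      k'∸2≢0 = >-nonZero (ℕ.m<n⇒0<n∸m 3≤k')

  countPair≡λ₂' : ∀ {a b} → a ≢ b → countPair a b Cs ≡ λ₂'
  countPair≡λ₂' {a} {b} a≢b = ℕ.*-cancelʳ-≡ λab λ₂' (k' ∸ 2) (begin
    λab * (k' ∸ 2)   ≡⟨ ℕ.*-comm λab (k' ∸ 2) ⟩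
    (k' ∸ 2) * λab   ≡⟨ k*p≡m*p+x⇒[k∸m]*p≡x k' 2 λab _ through-a-and-b ⟩
    (w ∸ 2) * λ'     ≡⟨ ℕ.*-comm (w ∸ 2) λ' ⟩
    λ' * (w ∸ 2)     ≡⟨ λ₂'-def ⟨
    λ₂' * (k' ∸ 2)   ∎)
    where
    open ≡-Reasoning
    λab : ℕ
    λab = countPair a b Cs
    through-a-and-b : k' * λab ≡ 2 * λab + (w ∸ 2) * λ'
    through-a-and-b = begin
      k' * λab
        ≡⟨ ∑-countTriple Cs ∣C∣≡k' a b ⟨
      ∑[ c < w ] countTriple a b c Cs
        ≡⟨ ∑-const-off₂ (λ c → countTriple a b c Cs) a≢b
             (λ c c≢a c≢b → λ'-triples a b c a≢b (≢-sym c≢a) (≢-sym c≢b)) ⟩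
      countTriple a b a Cs + countTriple a b b Cs + (w ∸ 2) * λ'
        ≡⟨ cong₂ (λ s t → s + t + (w ∸ 2) * λ') (countTriple-aba Cs a b) (countTriple-abb Cs a b) ⟩
      λab + λab + (w ∸ 2) * λ'
        ≡⟨ cong (λ t → λab + t + (w ∸ 2) * λ') (ℕ.+-identityʳ λab) ⟨
      2 * λab + (w ∸ 2) * λ'
        ∎

  countTriple-aaa≡r' : ∀ a → countTriple a a a Cs ≡ r'
  countTriple-aaa≡r' a =
    ℕ.*-cancelʳ-≡ ra r' ((k' ∸ 1) * (k' ∸ 2)) {{ℕ.m*n≢0 (k' ∸ 1) (k' ∸ 2)}} (begin
      ra * ((k' ∸ 1) * (k' ∸ 2))  ≡⟨ ℕ.*-assoc ra (k' ∸ 1) (k' ∸ 2) ⟨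
      ra * (k' ∸ 1) * (k' ∸ 2)    ≡⟨ cong (_* (k' ∸ 2)) (ℕ.*-comm ra (k' ∸ 1)) ⟩
      (k' ∸ 1) * ra * (k' ∸ 2)    ≡⟨ cong (_* (k' ∸ 2)) (k*p≡m*p+x⇒[k∸m]*p≡x k' 1 ra _ through-a) ⟩
      (w ∸ 1) * λ₂' * (k' ∸ 2)    ≡⟨ ℕ.*-assoc (w ∸ 1) λ₂' (k' ∸ 2) ⟩
      (w ∸ 1) * (λ₂' * (k' ∸ 2))  ≡⟨ cong ((w ∸ 1) *_) λ₂'-def ⟩
      (w ∸ 1) * (λ' * (w ∸ 2))    ≡⟨ x*[y*z]≡y*[x*z] (w ∸ 1) λ' (w ∸ 2) ⟩
      λ' * ((w ∸ 1) * (w ∸ 2))    ≡⟨ r'-def ⟨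
      r' * ((k' ∸ 1) * (k' ∸ 2))  ∎)
    where
    open ≡-Reasoning
    ra : ℕ
    ra = countTriple a a a Cs
    through-a : k' * ra ≡ 1 * ra + (w ∸ 1) * λ₂'
    through-a = begin
      k' * ra
        ≡⟨ cong (k' *_) (countTriple-aab Cs a a) ⟩
      k' * countPair a a Cs
        ≡⟨ ∑-countTriple Cs ∣C∣≡k' a a ⟨
      ∑[ c < w ] countTriple a a c Cs
        ≡⟨ ∑-const-off₁ (λ c → countTriple a a c Cs) a
             (λ c c≢a → trans (countTriple-aab Cs a c) (countPair≡λ₂' (≢-sym c≢a))) ⟩
      ra + (w ∸ 1) * λ₂'
        ≡⟨ cong (_+ (w ∸ 1) * λ₂') (ℕ.*-identityˡ ra) ⟨
      1 * ra + (w ∸ 1) * λ₂'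
        ∎

open import Data.Integer using (ℤ; +_; _-_) renaming (_*_ to _*ℤ_; _+_ to _+ℤ_)
open import Data.Integer.Properties using (pos-+)
open import Data.Integer.Tactic.RingSolver using (solve-∀)

pos-∑-affine : (f s t : Fin n → ℕ) (x y z : ℤ) →
  (∀ i → + f i ≡ x +ℤ + s i *ℤ y +ℤ + t i *ℤ z) →
  + sum f ≡ + n *ℤ x +ℤ + sum s *ℤ y +ℤ + sum t *ℤ z
pos-∑-affine {n = zero}  f s t x y z eq = refl
pos-∑-affine {n = suc n} f s t x y z eq = begin
  + (f zero + sum (f ∘ suc))
    ≡⟨ pos-+ (f zero) _ ⟩
  + f zero +ℤ + sum (f ∘ suc)
    ≡⟨ cong₂ _+ℤ_ (eq zero) (pos-∑-affine (f ∘ suc) (s ∘ suc) (t ∘ suc) x y z (eq ∘ suc)) ⟩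
  (x +ℤ + s zero *ℤ y +ℤ + t zero *ℤ z) +ℤ (+ n *ℤ x +ℤ + sum (s ∘ suc) *ℤ y +ℤ + sum (t ∘ suc) *ℤ z)
    ≡⟨ regroup x y z (+ n) (+ s zero) (+ sum (s ∘ suc)) (+ t zero) (+ sum (t ∘ suc)) ⟩
  (+ 1 +ℤ + n) *ℤ x +ℤ (+ s zero +ℤ + sum (s ∘ suc)) *ℤ y +ℤ (+ t zero +ℤ + sum (t ∘ suc)) *ℤ z
    ≡⟨ cong₂ (λ u v → u +ℤ v *ℤ z)
         (cong₂ (λ u v → u *ℤ x +ℤ v *ℤ y) (pos-+ 1 n) (pos-+ (s zero) _)) (pos-+ (t zero) _) ⟨
  + suc n *ℤ x +ℤ + sum s *ℤ y +ℤ + sum t *ℤ z ∎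
  where
  open ≡-Reasoning
  regroup : ∀ x y z n s S t T →
    (x +ℤ s *ℤ y +ℤ t *ℤ z) +ℤ (n *ℤ x +ℤ S *ℤ y +ℤ T *ℤ z)
    ≡ (+ 1 +ℤ n) *ℤ x +ℤ (s +ℤ S) *ℤ y +ℤ (t +ℤ T) *ℤ z
  regroup = solve-∀

private
  profile-distinct : ∀ l l₂ r → l ≡ l +ℤ + 0 *ℤ (l₂ - l) +ℤ + 0 *ℤ (r - + 3 *ℤ l₂ +ℤ + 2 *ℤ l)
  profile-distinct = solve-∀

  profile-pair : ∀ l l₂ r → l₂ ≡ l +ℤ + 1 *ℤ (l₂ - l) +ℤ + 0 *ℤ (r - + 3 *ℤ l₂ +ℤ + 2 *ℤ l)
  profile-pair = solve-∀

  profile-all : ∀ l l₂ r → r ≡ l +ℤ + 3 *ℤ (l₂ - l) +ℤ + 1 *ℤ (r - + 3 *ℤ l₂ +ℤ + 2 *ℤ l)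
  profile-all = solve-∀

-- The coincidence counts 0, 1, 3 and indicator 0, 0, 1 of the three patterns make this
-- affine expression take the values λ', λ₂', r'.
countTriple-by-coincidences : ∀ {λ' λ₂' r'} (Cs : List (Subset n)) →
  (∀ a b c → a ≢ b → a ≢ c → b ≢ c → countTriple a b c Cs ≡ λ') →
  (∀ {a b} → a ≢ b → countPair a b Cs ≡ λ₂') →
  (∀ a → countTriple a a a Cs ≡ r') →
  ∀ a b c → + countTriple a b c Cs
            ≡ + λ' +ℤ + coincidences a b c *ℤ (+ λ₂' - + λ')
                   +ℤ + χ (allEqual? a b c) *ℤ (+ r' - + 3 *ℤ + λ₂' +ℤ + 2 *ℤ + λ')
countTriple-by-coincidences {λ' = λ'} {λ₂'} {r'} Cs triple pair point a b c with a ≟ b | a ≟ c | b ≟ c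
... | yes refl | yes refl | yes _    = trans (cong +_ (point a)) (profile-all (+ λ') (+ λ₂') (+ r'))
... | yes refl | yes refl | no a≢a   = contradiction refl a≢a
... | yes refl | no a≢c  | yes a≡c  = contradiction a≡c a≢c
... | yes refl | no a≢c  | no _     =
  trans (cong +_ (trans (countTriple-aab Cs a c) (pair a≢c))) (profile-pair (+ λ') (+ λ₂') (+ r'))
... | no a≢b   | yes refl | yes b≡a = contradiction (sym b≡a) a≢b
... | no a≢b   | yes refl | no _    =
  trans (cong +_ (trans (countTriple-aba Cs a b) (pair a≢b))) (profile-pair (+ λ') (+ λ₂') (+ r'))
... | no a≢b   | no a≢c  | yes refl =
  trans (cong +_ (trans (countTriple-abb Cs a b) (pair a≢b))) (profile-pair (+ λ') (+ λ₂') (+ r'))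
... | no a≢b   | no a≢c  | no b≢c   =
  trans (cong +_ (triple a b c a≢b a≢c b≢c)) (profile-distinct (+ λ') (+ λ₂') (+ r'))

private
  closed-form : ∀ L α R l l₂ r′ →
    R *ℤ l +ℤ (L +ℤ L +ℤ L) *ℤ (l₂ - l) +ℤ α *ℤ (r′ - + 3 *ℤ l₂ +ℤ + 2 *ℤ l)
    ≡ (α *ℤ r′) +ℤ (+ 3 *ℤ (L - α) *ℤ l₂) +ℤ ((R - α - + 3 *ℤ (L - α)) *ℤ l)
  closed-form = solve-∀

lemma2p4 : (v k lam r w : ℕ) (P : Resolution v r w) → IsResolvableBIBD k lam P
    → (k' λ' : ℕ) (Cs : List (Subset w)) → Is3Design w k' λ' Cs
    → (λ₂' r' : ℕ) → λ₂' * (k' ∸ 2) ≡ λ' * (w ∸ 2)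
    → r' * ((k' ∸ 1) * (k' ∸ 2)) ≡ λ' * ((w ∸ 1) * (w ∸ 2))
    → (x y z : Fin v) → x ≢ y → x ≢ z → y ≢ z
    → (α : ℕ) → countTriple x y z (blocksOf P) ≡ α
    → + countTriple x y z (constructed P Cs)
      ≡ (+ α *ℤ + r') +ℤ (+ 3 *ℤ (+ lam - + α) *ℤ + λ₂')
        +ℤ ((+ r - + α - + 3 *ℤ (+ lam - + α)) *ℤ + λ')
lemma2p4 v k lam r w P ((_ , _ , v≡kw , ∣B∣≡k , disjoint) , λ-pairs) k' λ' Cs
  (3≤k' , _ , ∣C∣≡k' , λ'-triples) λ₂' r' λ₂'-def r'-def x y z x≢y x≢z y≢z α α-triples = begin
  + countTriple x y z (constructed P Cs)
    ≡⟨ cong +_ (countTriple-constructed Cs x y z) ⟩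
  + ∑[ i < r ] countTriple (ι x i) (ι y i) (ι z i) Cs
    ≡⟨ pos-∑-affine _ _ _ _ _ _ (λ i → countTriple-by-coincidences Cs λ'-triples countPair≡λ₂'
                                          countTriple-aaa≡r' (ι x i) (ι y i) (ι z i)) ⟩
  + r *ℤ + λ' +ℤ + ∑[ i < r ] coincidences (ι x i) (ι y i) (ι z i) *ℤ D₁
              +ℤ + ∑[ i < r ] χ (allEqual? (ι x i) (ι y i) (ι z i)) *ℤ D₂
    ≡⟨ cong₂ (λ m n → + r *ℤ + λ' +ℤ m *ℤ D₁ +ℤ n *ℤ D₂) pairs triples ⟩
  + r *ℤ + λ' +ℤ (+ lam +ℤ + lam +ℤ + lam) *ℤ D₁ +ℤ + α *ℤ D₂
    ≡⟨ closed-form (+ lam) (+ α) (+ r) (+ λ') (+ λ₂') (+ r') ⟩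
  (+ α *ℤ + r') +ℤ (+ 3 *ℤ (+ lam - + α) *ℤ + λ₂') +ℤ ((+ r - + α - + 3 *ℤ (+ lam - + α)) *ℤ + λ') ∎
  where
  open ≡-Reasoning
  open ResolutionCounts P v≡kw ∣B∣≡k disjoint renaming (blockIndex to ι)
  open ThreeDesignCounts Cs 3≤k' ∣C∣≡k' λ'-triples λ₂' r' λ₂'-def r'-def
  D₁ D₂ : ℤ
  D₁ = + λ₂' - + λ'
  D₂ = + r' - + 3 *ℤ + λ₂' +ℤ + 2 *ℤ + λ'
  pairs : + ∑[ i < r ] coincidences (ι x i) (ι y i) (ι z i) ≡ + lam +ℤ + lam +ℤ + lam
  pairs = begin
    + ∑[ i < r ] coincidences (ι x i) (ι y i) (ι z i)
      ≡⟨ cong +_ (∑-coincidences x y z) ⟩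
    + (countPair x y (blocksOf P) + countPair x z (blocksOf P) + countPair y z (blocksOf P))
      ≡⟨ cong +_ (cong₂ _+_ (cong₂ _+_ (λ-pairs x y x≢y) (λ-pairs x z x≢z)) (λ-pairs y z y≢z)) ⟩
    + (lam + lam + lam)
      ≡⟨ trans (pos-+ (lam + lam) lam) (cong (_+ℤ + lam) (pos-+ lam lam)) ⟩
    + lam +ℤ + lam +ℤ + lam ∎
  triples : + ∑[ i < r ] χ (allEqual? (ι x i) (ι y i) (ι z i)) ≡ + α
  triples = cong +_ (trans (sym (countTriple-blocksOf x y z)) α-triples)
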